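{- The maximum, over all $12$-element subsets $S\subseteq \mathbb{F}_3^4$, of the number of sets contained in $S$ is $14$.
   Context: Cards of the game SET (with $4$ properties, each taking $3$ values) are identified with points of $\mathbb{F}_3^4$. A set is a $3$-element subset $\{p,q,r\}$ of distinct points of $\mathbb{F}_3^4$ with $p+q+r=0$ (equivalently, an affine line in $\mathbb{F}_3^4$). The number of sets contained in $S$ is the number of $3$-element subsets of $S$ that are sets. -}

module Defs where

open import Data.Nat using (ℕ; zero; suc; _+_)
open import Data.Fin using (Fin; zero; suc)
open import Data.Vec using (Vec; zipWith; replicate)
open import Data.List using (List; []; _∷_)
open import Relation.Nullary using (Dec; yes; no)
open import Relation.Binary.PropositionalEquality using (_≡_)
import Data.Vec.Properties as VP
import Data.Fin.Properties as FP

F3 : Set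
F3 = Fin 3

infixl 6 _+₃_
_+₃_ : F3 → F3 → F3
zero +₃ y = y
suc zero +₃ zero = suc zero
suc zero +₃ suc zero = suc (suc zero)
suc zero +₃ suc (suc zero) = zero
suc (suc zero) +₃ zero = suc (suc zero)
suc (suc zero) +₃ suc zero = zero
suc (suc zero) +₃ suc (suc zero) = suc zero

Point : Set
Point = Vec F3 4

infixl 6 _⊕_
_⊕_ : Point → Point → Point
_⊕_ = zipWith _+₃_

origin : Point
origin = replicate 4 zero

infix 4 _≟ₚ_
_≟ₚ_ : (p q : Point) → Dec (p ≡ q)
_≟ₚ_ = VP.≡-dec FP._≟_

isSet : Point → Point → Point → ℕ
isSet p q r with (p ⊕ q) ⊕ r ≟ₚ origin
... | yes _ = 1
... | no _ = 0

-- For a list S = [s_1,...,s_n] of points, the number of index triples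
-- i < j < k with s_i + s_j + s_k = 0.  When S has no repetitions this is
-- exactly the number of 3-element subsets of S that are sets.
countWith2 : Point → Point → List Point → ℕ
countWith2 p q [] = 0
countWith2 p q (r ∷ rs) = isSet p q r + countWith2 p q rs

countWith1 : Point → List Point → ℕ
countWith1 p [] = 0
countWith1 p (q ∷ qs) = countWith2 p q qs + countWith1 p qs

numSets : List Point → ℕ
numSets [] = 0
numSets (p ∷ ps) = countWith1 p ps + numSets ps

-- Suppose S had at least fifteen sets. Counting the triples (x, y, z) of S with x + y + z = 0
-- gives Σₓ (1 + 2 · #{sets through x}) = 6 · numSets S + 12, so some x ∈ S lies on four sets,
-- with pairwise non-parallel directions d₁, …, d₄. In coordinates centred at x and adapted to the
-- linear dependencies of the dᵢ, the nine points x, x ± dᵢ form one of four configurations: a basis,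
-- three basis vectors and their sum, three basis vectors and the sum of two of them, or a plane.
-- Each of the three remaining points lies on few sets through two base points (bounded by a finite
-- computation, zero for a plane), and at most three sets contain two of them (two over a plane).
-- In every configuration this leaves at most 14 sets; in the third one, if S also contains the
-- missing points of the plane through the two summed directions, the plane bound applies instead.

module Submission where

open import Defs

open import Algebra.Bundles using (AbelianGroup)
open import Data.Empty using (⊥-elim)
open import Data.Fin using (Fin; zero; suc; combine; remQuot)
import Data.Fin.Properties as Fin
open import Data.Fin.Patterns using (0F; 1F; 2F; 3F)
open import Data.List using (List; []; _∷_; length; _++_; filter) renaming (map to mapL)
open import Data.List.Membership.Propositional using (_∈_; _∉_; find)
open import Data.List.Membership.Propositional.Properties using (∈-filter⁻; ∈-map⁺; ∈-∃++)
open import Data.List.Membership.DecPropositional _≟ₚ_ using (_∈?_)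
open import Data.List.Properties using (filter-all; length-map; length-++)
import Data.List.Relation.Unary.All as List
open import Data.List.Relation.Unary.All using ([]; _∷_)
open import Data.List.Relation.Unary.AllPairs using (AllPairs; []; _∷_)
import Data.List.Relation.Unary.Any as Any
open import Data.List.Relation.Unary.Any using (here; there)
open import Data.List.Relation.Unary.Unique.Propositional using (Unique)
import Data.List.Relation.Unary.Unique.Propositional.Properties as Unique
open import Data.List.Relation.Unary.Unique.DecPropositional _≟ₚ_ using (unique?)
open import Data.List.Relation.Binary.Permutation.Propositional
  using (_↭_; prep; swap; ↭-sym; ↭⇒↭ₛ) renaming (refl to ↭-refl; trans to ↭-trans)
open import Data.List.Relation.Binary.Permutation.Propositional.Properties using (shift; ∈-resp-↭; ↭-length; ++-comm)
open import Data.Nat using (ℕ; zero; suc; _+_; _*_; _^_; _≤_; _<_; z≤n; s≤s; _≤?_; _<?_)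
open import Data.Nat.Properties
  using (≤-refl; ≤-reflexive; ≤-trans; ≤-pred; ≰⇒>; ≮⇒≥; <⇒≱; m≤m+n; +-assoc; +-cancelˡ-≡; *-suc;
         +-mono-≤; +-monoˡ-≤; +-monoʳ-≤; *-monoʳ-≤; +-commutativeSemigroup)
open import Data.Nat.Solver using (module +-*-Solver)
open import Algebra.Properties.CommutativeSemigroup +-commutativeSemigroup
  using () renaming (interchange to ℕ-interchange; x∙yz≈y∙xz to ℕ-x∙yz≈y∙xz)
open import Data.Product using (_×_; _,_; proj₁; proj₂; ∃; Σ)
open import Data.Sum using (_⊎_; inj₁; inj₂)
open import Data.Vec using (Vec; []; _∷_; zipWith; map; replicate; lookup)
open import Data.Vec.Properties
  using (∷-injectiveˡ; ∷-injectiveʳ; ≡-dec; zipWith-assoc; zipWith-comm; zipWith-identityˡ; zipWith-identityʳ;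
         zipWith-inverseˡ; zipWith-inverseʳ)
open import Data.Vec.Relation.Unary.All using (All; []; _∷_)
open import Function using (_∘_)
open import Level using (0ℓ)
open import Relation.Binary.Definitions using (DecidableEquality)
open import Relation.Binary.PropositionalEquality
  using (_≡_; _≢_; refl; sym; trans; cong; cong₂; subst; subst₂; setoid; isEquivalence; module ≡-Reasoning)
open import Data.List.Relation.Binary.Permutation.Setoid.Properties (setoid Point) using (Unique-resp-↭)
open import Relation.Nullary using (¬_; Dec; yes; no)
open import Relation.Nullary.Decidable using (from-yes; map′; ¬?; _→-dec_; decidable-stable)

private variable
  k n : ℕ

-- The field F₃

neg₃ : F3 → F3
neg₃ 0F = 0F
neg₃ 1F = 2F
neg₃ 2F = 1F

infixl 7 _*₃_
_*₃_ : F3 → F3 → F3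
0F *₃ b = 0F
1F *₃ b = b
2F *₃ b = neg₃ b

+₃-comm : ∀ a b → a +₃ b ≡ b +₃ a
+₃-comm = from-yes (Fin.all? λ a → Fin.all? λ b → a +₃ b Fin.≟ b +₃ a)

+₃-assoc : ∀ a b c → (a +₃ b) +₃ c ≡ a +₃ (b +₃ c)
+₃-assoc = from-yes (Fin.all? λ a → Fin.all? λ b → Fin.all? λ c → (a +₃ b) +₃ c Fin.≟ a +₃ (b +₃ c))

+₃-identityʳ : ∀ a → a +₃ 0F ≡ a
+₃-identityʳ = from-yes (Fin.all? λ a → a +₃ 0F Fin.≟ a)

+₃-inverseˡ : ∀ a → neg₃ a +₃ a ≡ 0F
+₃-inverseˡ = from-yes (Fin.all? λ a → neg₃ a +₃ a Fin.≟ 0F)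

+₃-inverseʳ : ∀ a → a +₃ neg₃ a ≡ 0F
+₃-inverseʳ = from-yes (Fin.all? λ a → a +₃ neg₃ a Fin.≟ 0F)

+₃-double : ∀ a → a +₃ a ≡ neg₃ a
+₃-double = from-yes (Fin.all? λ a → a +₃ a Fin.≟ neg₃ a)

*₃-zero⇒zero : ∀ c a → a ≢ 0F → c *₃ a ≡ 0F → c ≡ 0F
*₃-zero⇒zero = from-yes (Fin.all? λ c → Fin.all? λ a →
  ¬? (a Fin.≟ 0F) →-dec (c *₃ a Fin.≟ 0F →-dec c Fin.≟ 0F))

-- The vector space F₃ⁿ

infixl 6 _⊞_
_⊞_ : Vec F3 n → Vec F3 n → Vec F3 n
_⊞_ = zipWith _+₃_

negV : Vec F3 n → Vec F3 n
negV = map neg₃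

0V : Vec F3 n
0V = replicate _ 0F

F3ⁿ : ℕ → AbelianGroup 0ℓ 0ℓ
F3ⁿ n = record
  { Carrier = Vec F3 n ; _≈_ = _≡_ ; _∙_ = _⊞_ ; ε = 0V ; _⁻¹ = negV
  ; isAbelianGroup = record
    { isGroup = record
      { isMonoid = record
        { isSemigroup = record
          { isMagma = record { isEquivalence = isEquivalence ; ∙-cong = cong₂ _⊞_ }
          ; assoc = zipWith-assoc +₃-assoc }
        ; identity = zipWith-identityˡ (λ _ → refl) , zipWith-identityʳ +₃-identityʳ }
      ; inverse = zipWith-inverseˡ +₃-inverseˡ , zipWith-inverseʳ +₃-inverseʳ
      ; ⁻¹-cong = cong negV }
    ; comm = zipWith-comm +₃-comm } }

module _ {n : ℕ} where
  open AbelianGroup (F3ⁿ n) public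
    using () renaming (assoc to ⊞-assoc; comm to ⊞-comm; identityˡ to ⊞-identityˡ;
                       identityʳ to ⊞-identityʳ; inverseˡ to ⊞-inverseˡ; inverseʳ to ⊞-inverseʳ)
  open import Algebra.Properties.AbelianGroup (F3ⁿ n) public
    using (⁻¹-involutive; ⁻¹-∙-comm; ε⁻¹≈ε; inverseʳ-unique; x∙y⁻¹≈ε⇒x≈y; xyx⁻¹≈y)
  open import Algebra.Properties.CommutativeSemigroup (AbelianGroup.commutativeSemigroup (F3ⁿ n)) public
    using (interchange; x∙yz≈y∙xz)

⊞-double : (v : Vec F3 n) → v ⊞ v ≡ negV v
⊞-double []       = refl
⊞-double (a ∷ v) = cong₂ _∷_ (+₃-double a) (⊞-double v)

-- By cases on the scalar, so that 1 · v reduces to v.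
infixr 7 _·_
_·_ : F3 → Vec F3 n → Vec F3 n
0F · v = 0V
1F · v = v
2F · v = negV v

·-distribʳ : ∀ a b (v : Vec F3 n) → (a +₃ b) · v ≡ a · v ⊞ b · v
·-distribʳ 0F b  v = sym (⊞-identityˡ (b · v))
·-distribʳ 1F 0F v = sym (⊞-identityʳ v)
·-distribʳ 1F 1F v = sym (⊞-double v)
·-distribʳ 1F 2F v = sym (⊞-inverseʳ v)
·-distribʳ 2F 0F v = sym (⊞-identityʳ (negV v))
·-distribʳ 2F 1F v = sym (⊞-inverseˡ v)
·-distribʳ 2F 2F v = sym (trans (⊞-double (negV v)) (⁻¹-involutive v))

·-assoc : ∀ a b (v : Vec F3 n) → (a *₃ b) · v ≡ a · (b · v)
·-assoc 0F b  v = refl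
·-assoc 1F b  v = refl
·-assoc 2F 0F v = sym ε⁻¹≈ε
·-assoc 2F 1F v = refl
·-assoc 2F 2F v = sym (⁻¹-involutive v)

·-neg : ∀ a (v : Vec F3 n) → neg₃ a · v ≡ negV (a · v)
·-neg 0F v = sym ε⁻¹≈ε
·-neg 1F v = refl
·-neg 2F v = sym (⁻¹-involutive v)

-- Linear combinations, independence and span

lin : Vec F3 k → Vec (Vec F3 n) k → Vec F3 n
lin []       []       = 0V
lin (a ∷ as) (v ∷ vs) = a · v ⊞ lin as vs

lin-⊞ : (as bs : Vec F3 k) (vs : Vec (Vec F3 n) k) → lin (as ⊞ bs) vs ≡ lin as vs ⊞ lin bs vs
lin-⊞ []       []       []       = sym (⊞-identityʳ 0V)
lin-⊞ (a ∷ as) (b ∷ bs) (v ∷ vs) = trans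
  (cong₂ _⊞_ (·-distribʳ a b v) (lin-⊞ as bs vs))
  (interchange (a · v) (b · v) (lin as vs) (lin bs vs))

lin-neg : (as : Vec F3 k) (vs : Vec (Vec F3 n) k) → lin (negV as) vs ≡ negV (lin as vs)
lin-neg []       []       = sym ε⁻¹≈ε
lin-neg (a ∷ as) (v ∷ vs) = trans
  (cong₂ _⊞_ (·-neg a v) (lin-neg as vs))
  (⁻¹-∙-comm (a · v) (lin as vs))

lin-0V : (vs : Vec (Vec F3 n) k) → lin 0V vs ≡ 0V
lin-0V []       = refl
lin-0V (v ∷ vs) = trans (⊞-identityˡ (lin 0V vs)) (lin-0V vs)

lin-0∷ : ∀ (as : Vec F3 k) (u : Vec F3 n) vs → lin (0F ∷ as) (u ∷ vs) ≡ lin as vs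
lin-0∷ as u vs = ⊞-identityˡ (lin as vs)

lin-swap : ∀ a b (cs : Vec F3 k) (u v : Vec F3 n) vs →
  lin (a ∷ b ∷ cs) (u ∷ v ∷ vs) ≡ lin (b ∷ a ∷ cs) (v ∷ u ∷ vs)
lin-swap a b cs u v vs = x∙yz≈y∙xz (a · u) (b · v) (lin cs vs)

lin-scale : (cs as : Vec F3 k) (vs : Vec (Vec F3 n) k) →
  lin cs (zipWith _·_ as vs) ≡ lin (zipWith _*₃_ cs as) vs
lin-scale []       []       []       = refl
lin-scale (c ∷ cs) (a ∷ as) (v ∷ vs) = cong₂ _⊞_ (sym (·-assoc c a v)) (lin-scale cs as vs)

unitVec : Fin k → Vec F3 k
unitVec zero    = 1F ∷ 0V
unitVec (suc i) = 0F ∷ unitVec i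

lin-unitVec : (i : Fin k) (vs : Vec (Vec F3 n) k) → lin (unitVec i) vs ≡ lookup vs i
lin-unitVec zero    (v ∷ vs) = trans (cong (v ⊞_) (lin-0V vs)) (⊞-identityʳ v)
lin-unitVec (suc i) (v ∷ vs) = trans (lin-0∷ (unitVec i) v vs) (lin-unitVec i vs)

Independent : Vec (Vec F3 n) k → Set
Independent vs = ∀ cs → lin cs vs ≡ 0V → cs ≡ 0V

InSpan : Vec F3 n → Vec (Vec F3 n) k → Set
InSpan {k = k} v vs = Σ (Vec F3 k) λ cs → lin cs vs ≡ v

independent-∷ : {v : Vec F3 n} {vs : Vec (Vec F3 n) k} → Independent vs → ¬ InSpan v vs → Independent (v ∷ vs)
independent-∷ {v = v} {vs} ind ∉span (0F ∷ cs) e = cong (0F ∷_) (ind cs (trans (sym (lin-0∷ cs v vs)) e))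
independent-∷ {v = v} {vs} ind ∉span (1F ∷ cs) e =
  ⊥-elim (∉span (negV cs , trans (lin-neg cs vs) (trans (cong negV (inverseʳ-unique v (lin cs vs) e)) (⁻¹-involutive v))))
independent-∷ {v = v} {vs} ind ∉span (2F ∷ cs) e =
  ⊥-elim (∉span (cs , trans (inverseʳ-unique (negV v) (lin cs vs) e) (⁻¹-involutive v)))

independent-swap : {u v : Vec F3 n} {vs : Vec (Vec F3 n) k} → Independent (u ∷ v ∷ vs) → Independent (v ∷ u ∷ vs)
independent-swap {u = u} {v} {vs} ind (a ∷ b ∷ cs) e
  with ind (b ∷ a ∷ cs) (trans (lin-swap b a cs u v vs) e)
... | refl = refl

independent-swap₂ : {w u v : Vec F3 n} {vs : Vec (Vec F3 n) k} →
  Independent (w ∷ u ∷ v ∷ vs) → Independent (w ∷ v ∷ u ∷ vs)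
independent-swap₂ {w = w} {u} {v} {vs} ind (c ∷ a ∷ b ∷ cs) e
  with ind (c ∷ b ∷ a ∷ cs) (trans (cong (c · w ⊞_) (lin-swap b a cs u v vs)) e)
... | refl = refl

zipWith-*₃-zero : (cs as : Vec F3 k) → All (_≢ 0F) as → zipWith _*₃_ cs as ≡ 0V → cs ≡ 0V
zipWith-*₃-zero []       []       []         e = refl
zipWith-*₃-zero (c ∷ cs) (a ∷ as) (a≢0 ∷ us) e =
  cong₂ _∷_ (*₃-zero⇒zero c a a≢0 (∷-injectiveˡ e)) (zipWith-*₃-zero cs as us (∷-injectiveʳ e))

independent-scale : {vs : Vec (Vec F3 n) k} (as : Vec F3 k) → All (_≢ 0F) as → Independent vs → Independent (zipWith _·_ as vs)
independent-scale {vs = vs} as units ind cs e = zipWith-*₃-zero cs as units (ind _ (trans (sym (lin-scale cs as vs)) e))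

independent⇒injective : {vs : Vec (Vec F3 n) k} → Independent vs → ∀ {as bs} → lin as vs ≡ lin bs vs → as ≡ bs
independent⇒injective {vs = vs} ind {as} {bs} e = x∙y⁻¹≈ε⇒x≈y as bs (ind (as ⊞ negV bs) (begin
  lin (as ⊞ negV bs) vs          ≡⟨ lin-⊞ as (negV bs) vs ⟩
  lin as vs ⊞ lin (negV bs) vs   ≡⟨ cong₂ _⊞_ e (lin-neg bs vs) ⟩
  lin bs vs ⊞ negV (lin bs vs)   ≡⟨ ⊞-inverseʳ (lin bs vs) ⟩
  0V                             ∎))
  where open ≡-Reasoning

-- Counting: F₃ᵏ has 3 ^ k elements

encode : Vec F3 k → Fin (3 ^ k)
encode []      = zero
encode (a ∷ v) = combine a (encode v)

decode : ∀ k → Fin (3 ^ k) → Vec F3 k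
decode zero    _ = []
decode (suc k) i = proj₁ (remQuot {3} (3 ^ k) i) ∷ decode k (proj₂ (remQuot {3} (3 ^ k) i))

decode-encode : (v : Vec F3 k) → decode k (encode v) ≡ v
decode-encode []              = refl
decode-encode {suc k} (a ∷ v) = trans
  (cong (λ (b , i) → b ∷ decode k i) (Fin.remQuot-combine {3} {3 ^ k} a (encode v)))
  (cong (a ∷_) (decode-encode v))

encode-decode : ∀ k (i : Fin (3 ^ k)) → encode (decode k i) ≡ i
encode-decode zero    zero = refl
encode-decode (suc k) i    = trans
  (cong (combine (proj₁ (remQuot {3} (3 ^ k) i))) (encode-decode k (proj₂ (remQuot {3} (3 ^ k) i))))
  (Fin.combine-remQuot {3} (3 ^ k) i)

injection⇒≤ : ∀ {m n} (f : Vec F3 m → Vec F3 n) → (∀ {a b} → f a ≡ f b → a ≡ b) → 3 ^ m ≤ 3 ^ n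
injection⇒≤ {m} f f-inj = Fin.injective⇒≤ {f = encode ∘ f ∘ decode m} λ {i} {j} e → begin
  i                      ≡⟨ encode-decode m i ⟨
  encode (decode m i)    ≡⟨ cong encode (f-inj (begin
    f (decode m i)                    ≡⟨ decode-encode _ ⟨
    decode _ (encode (f (decode m i))) ≡⟨ cong (decode _) e ⟩
    decode _ (encode (f (decode m j))) ≡⟨ decode-encode _ ⟩
    f (decode m j)                    ∎)) ⟩
  encode (decode m j)    ≡⟨ encode-decode m j ⟩
  j                      ∎
  where open ≡-Reasoning

search : {P : Vec F3 k → Set} → (∀ v → Dec (P v)) → Dec (∃ P)
search {k} {P} P? with Fin.any? (P? ∘ decode k)
... | yes (i , p) = yes (decode k i , p)
... | no ¬p       = no λ (v , p) → ¬p (encode v , subst P (sym (decode-encode v)) p)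

every? : ∀ k {P : Vec F3 k → Set} → (∀ v → Dec (P v)) → Dec (∀ v → P v)
every? zero    P? = map′ (λ p → λ { [] → p }) (λ all → all []) (P? [])
every? (suc k) P? = map′ (λ all → λ { (a ∷ v) → all a v }) (λ all a v → all (a ∷ v))
  (Fin.all? λ a → every? k (λ v → P? (a ∷ v)))

inSpan? : (v : Vec F3 n) (vs : Vec (Vec F3 n) k) → Dec (InSpan v vs)
inSpan? v vs = search λ cs → ≡-dec Fin._≟_ (lin cs vs) v

-- Abstract, so that type checking never unfolds the exhaustive searches.
abstract
  basis-spans : {us : Vec Point 4} → Independent us → ∀ y → InSpan y us
  basis-spans {us} ind y = decidable-stable (inSpan? y us) λ y∉span →
    <⇒≱ (from-yes (3 ^ 4 <? 3 ^ 5)) (injection⇒≤ (λ cs → lin cs (y ∷ us)) (independent⇒injective (independent-∷ ind y∉span)))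

  extend : {vs : Vec Point k} → 3 ^ k < 3 ^ 4 → Independent vs → ∃ λ e → Independent (e ∷ vs)
  extend {k} {vs} small ind with search (λ y → ¬? (inSpan? y vs))
  ... | yes (e , e∉span) = e , independent-∷ ind e∉span
  ... | no  all-spanned  = ⊥-elim (<⇒≱ small (injection⇒≤ coefficients coefficients-injective))
    where
    spanned : ∀ y → InSpan y vs
    spanned y = decidable-stable (inSpan? y vs) (λ y∉span → all-spanned (y , y∉span))
    coefficients : Point → Vec F3 k
    coefficients y = proj₁ (spanned y)
    coefficients-injective : ∀ {a b} → coefficients a ≡ coefficients b → a ≡ b
    coefficients-injective {a} {b} e =
      trans (sym (proj₂ (spanned a))) (trans (cong (λ cs → lin cs vs) e) (proj₂ (spanned b)))

record Coordinates (us : Vec Point 4) : Set where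
  field
    coord           : Point → Point
    coord-lin       : ∀ cs → coord (lin cs us) ≡ cs
    coord-⊞         : ∀ a b → coord (a ⊞ b) ≡ coord a ⊞ coord b
    coord-injective : ∀ {a b} → coord a ≡ coord b → a ≡ b

coordinates : {us : Vec Point 4} → Independent us → Coordinates us
coordinates {us} ind = record
  { coord = coord ; coord-lin = coord-lin ; coord-⊞ = coord-⊞ ; coord-injective = coord-injective }
  where
  coord : Point → Point
  coord y = proj₁ (basis-spans ind y)
  lin-coord : ∀ y → lin (coord y) us ≡ y
  lin-coord y = proj₂ (basis-spans ind y)
  coord-lin : ∀ cs → coord (lin cs us) ≡ cs
  coord-lin cs = independent⇒injective ind (lin-coord (lin cs us))
  coord-⊞ : ∀ a b → coord (a ⊞ b) ≡ coord a ⊞ coord b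
  coord-⊞ a b = independent⇒injective ind (trans (lin-coord (a ⊞ b))
    (sym (trans (lin-⊞ (coord a) (coord b) us) (cong₂ _⊞_ (lin-coord a) (lin-coord b)))))
  coord-injective : ∀ {a b} → coord a ≡ coord b → a ≡ b
  coord-injective {a} {b} e = trans (sym (lin-coord a)) (trans (cong (λ cs → lin cs us) e) (lin-coord b))

-- Sets

third : Vec F3 n → Vec F3 n → Vec F3 n
third p q = negV (p ⊞ q)

third-self : (a : Vec F3 n) → third a a ≡ a
third-self a = trans (cong negV (⊞-double a)) (⁻¹-involutive a)

isSet-cases : ∀ p q r → isSet p q r ≡ 0 ⊎ isSet p q r ≡ 1
isSet-cases p q r with (p ⊕ q) ⊕ r ≟ₚ origin
... | yes _ = inj₂ refl
... | no  _ = inj₁ refl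

isSet≡1⇒third : ∀ p q r → isSet p q r ≡ 1 → r ≡ third p q
isSet≡1⇒third p q r e with (p ⊕ q) ⊕ r ≟ₚ origin
... | yes sum≡0 = inverseʳ-unique (p ⊞ q) r sum≡0

isSet-third : ∀ p q → isSet p q (third p q) ≡ 1
isSet-third p q with (p ⊕ q) ⊕ third p q ≟ₚ origin
... | yes _   = refl
... | no  ≢0 = ⊥-elim (≢0 (⊞-inverseʳ (p ⊞ q)))

isSet-≢third : ∀ p q r → r ≢ third p q → isSet p q r ≡ 0
isSet-≢third p q r r≢ with (p ⊕ q) ⊕ r ≟ₚ origin
... | yes sum≡0 = ⊥-elim (r≢ (inverseʳ-unique (p ⊞ q) r sum≡0))
... | no  _     = refl

isSet-cong : ∀ {p q r p′ q′ r′} → (p ⊕ q) ⊕ r ≡ (p′ ⊕ q′) ⊕ r′ → isSet p q r ≡ isSet p′ q′ r′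
isSet-cong {p} {q} {r} {p′} {q′} {r′} e with (p ⊕ q) ⊕ r ≟ₚ origin | (p′ ⊕ q′) ⊕ r′ ≟ₚ origin
... | yes _   | yes _   = refl
... | no  _   | no  _   = refl
... | yes s≡0 | no  s≢0 = ⊥-elim (s≢0 (trans (sym e) s≡0))
... | no  s≢0 | yes s≡0 = ⊥-elim (s≢0 (trans e s≡0))

isSet-swap₁₂ : ∀ p q r → isSet p q r ≡ isSet q p r
isSet-swap₁₂ p q r = isSet-cong (cong (_⊞ r) (⊞-comm p q))

isSet-swap₂₃ : ∀ p q r → isSet p q r ≡ isSet p r q
isSet-swap₂₃ p q r = isSet-cong (trans (⊞-assoc p q r) (trans (cong (p ⊞_) (⊞-comm q r)) (sym (⊞-assoc p r q))))

isSet-swap₁₃ : ∀ p q r → isSet p q r ≡ isSet r q p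
isSet-swap₁₃ p q r = trans (isSet-swap₁₂ p q r) (trans (isSet-swap₂₃ q p r) (isSet-swap₁₂ q r p))

isSet-diagonal : ∀ a y → y ≢ a → isSet a a y ≡ 0
isSet-diagonal a y y≢a = isSet-≢third a a y (λ e → y≢a (trans e (third-self a)))

-- Counting sets in lists

∑ : (Point → ℕ) → List Point → ℕ
∑ f []       = 0
∑ f (x ∷ xs) = f x + ∑ f xs

module _ {f g : Point → ℕ} where

  ∑-cong : ∀ xs → (∀ y → y ∈ xs → f y ≡ g y) → ∑ f xs ≡ ∑ g xs
  ∑-cong []       _  = refl
  ∑-cong (x ∷ xs) eq = cong₂ _+_ (eq x (here refl)) (∑-cong xs (λ y → eq y ∘ there))

  ∑-+ : ∀ xs → ∑ (λ y → f y + g y) xs ≡ ∑ f xs + ∑ g xs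
  ∑-+ []       = refl
  ∑-+ (x ∷ xs) = trans (cong (f x + g x +_) (∑-+ xs)) (ℕ-interchange (f x) (g x) (∑ f xs) (∑ g xs))

∑-zero : ∀ {f} xs → (∀ y → y ∈ xs → f y ≡ 0) → ∑ f xs ≡ 0
∑-zero []       _  = refl
∑-zero (x ∷ xs) eq = cong₂ _+_ (eq x (here refl)) (∑-zero xs (λ y → eq y ∘ there))

∑-↭ : ∀ f {xs ys} → xs ↭ ys → ∑ f xs ≡ ∑ f ys
∑-↭ f ↭-refl                         = refl
∑-↭ f (prep x p)                     = cong (f x +_) (∑-↭ f p)
∑-↭ f (swap {xs = xs} {ys = ys} x y p) = trans (ℕ-x∙yz≈y∙xz (f x) (f y) (∑ f xs)) (cong (λ s → f y + (f x + s)) (∑-↭ f p))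
∑-↭ f (↭-trans p q)                  = trans (∑-↭ f p) (∑-↭ f q)

countWith2≡∑ : ∀ p q xs → countWith2 p q xs ≡ ∑ (isSet p q) xs
countWith2≡∑ p q []       = refl
countWith2≡∑ p q (x ∷ xs) = cong (isSet p q x +_) (countWith2≡∑ p q xs)

countWith2-swap : ∀ p q xs → countWith2 p q xs ≡ countWith2 q p xs
countWith2-swap p q []       = refl
countWith2-swap p q (x ∷ xs) = cong₂ _+_ (isSet-swap₁₂ p q x) (countWith2-swap p q xs)

countWith2-∉ : ∀ p q xs → third p q ∉ xs → countWith2 p q xs ≡ 0
countWith2-∉ p q xs t∉ = trans (countWith2≡∑ p q xs)
  (∑-zero xs λ r r∈ → isSet-≢third p q r λ { refl → t∉ r∈ })

countWith2≤1 : ∀ p q {xs} → Unique xs → countWith2 p q xs ≤ 1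
countWith2≤1 p q {[]}     _ = z≤n
countWith2≤1 p q {r ∷ rs} (r∉rs ∷ u) with (p ⊕ q) ⊕ r ≟ₚ origin
... | no  _     = countWith2≤1 p q u
... | yes sum≡0 = s≤s (≤-reflexive (countWith2-∉ p q rs λ t∈ →
                    List.lookup r∉rs t∈ (inverseʳ-unique (p ⊞ q) r sum≡0)))

countWith2-pos : ∀ p q xs → 1 ≤ countWith2 p q xs → third p q ∈ xs
countWith2-pos p q (r ∷ rs) pos with (p ⊕ q) ⊕ r ≟ₚ origin
... | yes sum≡0 = here (sym (inverseʳ-unique (p ⊞ q) r sum≡0))
... | no  _     = there (countWith2-pos p q rs pos)

countWith2-↭ : ∀ p q {xs ys} → xs ↭ ys → countWith2 p q xs ≡ countWith2 p q ys
countWith2-↭ p q {xs} {ys} π = trans (countWith2≡∑ p q xs) (trans (∑-↭ (isSet p q) π) (sym (countWith2≡∑ p q ys)))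

countWith1-↭ : ∀ p {xs ys} → xs ↭ ys → countWith1 p xs ≡ countWith1 p ys
countWith1-↭ p ↭-refl        = refl
countWith1-↭ p (prep x π)    = cong₂ _+_ (countWith2-↭ p x π) (countWith1-↭ p π)
countWith1-↭ p (swap {xs = xs} {ys = ys} x y π) = trans
  (ℕ-interchange (isSet p x y) (countWith2 p x xs) (countWith2 p y xs) (countWith1 p xs))
  (cong₂ _+_ (cong₂ _+_ (isSet-swap₂₃ p x y) (countWith2-↭ p y π)) (cong₂ _+_ (countWith2-↭ p x π) (countWith1-↭ p π)))
countWith1-↭ p (↭-trans π ρ) = trans (countWith1-↭ p π) (countWith1-↭ p ρ)

numSets-↭ : ∀ {xs ys} → xs ↭ ys → numSets xs ≡ numSets ys
numSets-↭ ↭-refl        = refl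
numSets-↭ (prep x π)    = cong₂ _+_ (countWith1-↭ x π) (numSets-↭ π)
numSets-↭ (swap {xs = xs} {ys = ys} x y π) = trans
  (ℕ-interchange (countWith2 x y xs) (countWith1 x xs) (countWith1 y xs) (numSets xs))
  (cong₂ _+_ (cong₂ _+_ (trans (countWith2-swap x y xs) (countWith2-↭ y x π)) (countWith1-↭ y π)) (cong₂ _+_ (countWith1-↭ x π) (numSets-↭ π)))
numSets-↭ (↭-trans π ρ) = trans (numSets-↭ π) (numSets-↭ ρ)

LinePreserving : (Point → Point) → Set
LinePreserving f = ∀ p q r → (p ⊕ q) ⊕ r ≡ origin → (f p ⊕ f q) ⊕ f r ≡ origin

module _ {f : Point → Point} (f-lines : LinePreserving f) where

  isSet-map-≤ : ∀ p q r → isSet p q r ≤ isSet (f p) (f q) (f r)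
  isSet-map-≤ p q r with (p ⊕ q) ⊕ r ≟ₚ origin | (f p ⊕ f q) ⊕ f r ≟ₚ origin
  ... | no  _   | _       = z≤n
  ... | yes _   | yes _   = ≤-refl
  ... | yes s≡0 | no  s≢0 = ⊥-elim (s≢0 (f-lines p q r s≡0))

  countWith2-map-≤ : ∀ p q xs → countWith2 p q xs ≤ countWith2 (f p) (f q) (mapL f xs)
  countWith2-map-≤ p q []       = z≤n
  countWith2-map-≤ p q (x ∷ xs) = +-mono-≤ (isSet-map-≤ p q x) (countWith2-map-≤ p q xs)

  countWith1-map-≤ : ∀ p xs → countWith1 p xs ≤ countWith1 (f p) (mapL f xs)
  countWith1-map-≤ p []       = z≤n
  countWith1-map-≤ p (x ∷ xs) = +-mono-≤ (countWith2-map-≤ p x xs) (countWith1-map-≤ p xs)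

  numSets-map-≤ : ∀ xs → numSets xs ≤ numSets (mapL f xs)
  numSets-map-≤ []       = z≤n
  numSets-map-≤ (x ∷ xs) = +-mono-≤ (countWith1-map-≤ x xs) (numSets-map-≤ xs)

-- Double counting: a point on four sets

-- For x ∈ S this is 1 + 2 · (the number of sets of S containing x).
linePairs : Point → List Point → ℕ
linePairs x S = ∑ (λ y → countWith2 x y S) S

∉⇒≢ : ∀ {a : Point} {xs y} → a ∉ xs → y ∈ xs → y ≢ a
∉⇒≢ a∉ y∈ refl = a∉ y∈

linePairs-∉ : ∀ a s → a ∉ s → linePairs a s ≡ 2 * countWith1 a s
linePairs-∉ a []       _  = refl
linePairs-∉ a (y ∷ ys) a∉ = begin
  (isSet a y y + countWith2 a y ys) + ∑ (λ z → isSet a z y + countWith2 a z ys) ys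
    ≡⟨ cong₂ _+_ (cong (_+ countWith2 a y ys) ayy≡0) (∑-+ ys) ⟩
  countWith2 a y ys + (∑ (λ z → isSet a z y) ys + linePairs a ys)
    ≡⟨ cong (λ t → countWith2 a y ys + (t + linePairs a ys)) ∑azy≡ ⟩
  countWith2 a y ys + (countWith2 a y ys + linePairs a ys)
    ≡⟨ cong (λ t → countWith2 a y ys + (countWith2 a y ys + t)) (linePairs-∉ a ys (a∉ ∘ there)) ⟩
  countWith2 a y ys + (countWith2 a y ys + 2 * countWith1 a ys)
    ≡⟨ arithmetic (countWith2 a y ys) (countWith1 a ys) ⟩
  2 * countWith1 a (y ∷ ys) ∎
  where
  open ≡-Reasoning
  arithmetic : ∀ c w → c + (c + 2 * w) ≡ 2 * (c + w)
  arithmetic = solve 2 (λ c w → c :+ (c :+ con 2 :* w) := con 2 :* (c :+ w)) refl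
    where open +-*-Solver
  ayy≡0 : isSet a y y ≡ 0
  ayy≡0 = trans (isSet-swap₁₃ a y y) (isSet-diagonal y a (a∉ ∘ here))
  ∑azy≡ : ∑ (λ z → isSet a z y) ys ≡ countWith2 a y ys
  ∑azy≡ = trans (∑-cong ys λ z _ → isSet-swap₂₃ a z y) (sym (countWith2≡∑ a y ys))

∑linePairs : ∀ S → Unique S → ∑ (λ x → linePairs x S) S ≡ 6 * numSets S + length S
∑linePairs []       _             = refl
∑linePairs (a ∷ s) (a∉s′ ∷ s-uniq) = begin
  linePairs a (a ∷ s) + ∑ (λ x → linePairs x (a ∷ s)) s
    ≡⟨ cong₂ _+_ self (trans (∑-cong s others) (trans (∑-+ s) (cong (_+ ∑ (λ x → linePairs x s) s) (∑-+ s)))) ⟩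
  (1 + linePairs a s) + ((linePairs a s + linePairs a s) + ∑ (λ x → linePairs x s) s)
    ≡⟨ cong₂ (λ l t → (1 + l) + ((l + l) + t)) (linePairs-∉ a s a∉s) (∑linePairs s s-uniq) ⟩
  (1 + 2 * countWith1 a s) + ((2 * countWith1 a s + 2 * countWith1 a s) + (6 * numSets s + length s))
    ≡⟨ arithmetic (countWith1 a s) (numSets s) (length s) ⟩
  6 * numSets (a ∷ s) + length (a ∷ s) ∎
  where
  open ≡-Reasoning
  arithmetic : ∀ c m l → (1 + 2 * c) + ((2 * c + 2 * c) + (6 * m + l)) ≡ 6 * (c + m) + suc l
  arithmetic = solve 3 (λ c m l → (con 1 :+ con 2 :* c) :+ ((con 2 :* c :+ con 2 :* c) :+ (con 6 :* m :+ l))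
                                := con 6 :* (c :+ m) :+ (con 1 :+ l)) refl
    where open +-*-Solver
  a∉s : a ∉ s
  a∉s a∈s = List.lookup a∉s′ a∈s refl
  self : linePairs a (a ∷ s) ≡ 1 + linePairs a s
  self = cong₂ _+_
    (cong₂ _+_ (trans (cong (isSet a a) (sym (third-self a))) (isSet-third a a))
               (trans (countWith2≡∑ a a s) (∑-zero s λ y y∈ → isSet-diagonal a y (∉⇒≢ a∉s y∈))))
    (trans (∑-+ s) (cong (_+ linePairs a s)
      (∑-zero s λ y y∈ → trans (isSet-swap₂₃ a y a) (isSet-diagonal a y (∉⇒≢ a∉s y∈)))))
  others : ∀ x → x ∈ s → linePairs x (a ∷ s) ≡ (countWith2 a x s + countWith2 a x s) + linePairs x s
  others x x∈ = trans
    (cong₂ _+_ (cong₂ _+_ (trans (isSet-swap₁₃ x a a) (isSet-diagonal a x (∉⇒≢ a∉s x∈))) (countWith2-swap x a s))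
               (trans (∑-+ s) (cong (_+ linePairs x s) (trans (∑-cong s λ y _ → trans (isSet-swap₁₃ x y a) (isSet-swap₂₃ a y x))
                                                    (sym (countWith2≡∑ a x s))))))
    (sym (+-assoc (countWith2 a x s) _ (linePairs x s)))

∑-≤ : ∀ {f k} xs → (∀ x → x ∈ xs → f x ≤ k) → ∑ f xs ≤ k * length xs
∑-≤ []       _ = z≤n
∑-≤ {f} {k} (x ∷ xs) bounded = subst (f x + ∑ f xs ≤_) (sym (*-suc k (length xs)))
  (+-mono-≤ (bounded x (here refl)) (∑-≤ xs (λ y → bounded y ∘ there)))

∑-large : ∀ f k xs → k * length xs < ∑ f xs → ∃ λ x → x ∈ xs × k < f x
∑-large f k xs large with Any.any? (λ x → k <? f x) xs
... | yes some = find some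
... | no  none = ⊥-elim (<⇒≱ large (∑-≤ xs λ x x∈ → ≮⇒≥ (λ k<fx → none (Any.map (λ { refl → k<fx }) x∈))))

∑-≤-filter : ∀ {P : Point → Set} (P? : ∀ y → Dec (P y)) f xs →
  (∀ y → f y ≤ 1) → (∀ y → 1 ≤ f y → P y) → ∑ f xs ≤ length (filter P? xs)
∑-≤-filter P? f []       _  _    = z≤n
∑-≤-filter P? f (x ∷ xs) ≤1 pos with P? x | f x in fx
... | yes _ | _     = +-mono-≤ (subst (_≤ 1) fx (≤1 x)) (∑-≤-filter P? f xs ≤1 pos)
... | no  _ | zero  = ∑-≤-filter P? f xs ≤1 pos
... | no ¬p | suc _ = ⊥-elim (¬p (pos x (subst (1 ≤_) (sym fx) (s≤s z≤n))))

module _ {A : Set} (_≟_ : DecidableEquality A) where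

  length-filter-≢ : ∀ w xs → Unique xs → length xs ≤ suc (length (filter (λ z → ¬? (z ≟ w)) xs))
  length-filter-≢ w []       _          = z≤n
  length-filter-≢ w (x ∷ xs) (x∉xs ∷ u) with x ≟ w
  ... | no  _    = s≤s (length-filter-≢ w xs u)
  ... | yes refl = s≤s (≤-reflexive (cong length (sym (filter-all (λ z → ¬? (z ≟ w)) (List.map (λ w≢z z≡w → w≢z (sym z≡w)) x∉xs)))))

  spread : (σ : A → A) → ∀ k (G : List A) → Unique G → 2 * k ≤ length G →
    Σ (List A) λ ys → length ys ≡ k × (∀ {y} → y ∈ ys → y ∈ G) × AllPairs (λ a b → b ≢ a × b ≢ σ a) ys
  spread σ zero    G        _          _  = [] , refl , (λ ()) , []
  spread σ (suc k) (y ∷ G₀) (y∉G₀ ∷ u) le =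
    let (ys , len , ys⊆G₁ , pairs) = spread σ k G₁ (Unique.filter⁺ _ u) room
    in  y ∷ ys , cong suc len , (λ { (here refl) → here refl ; (there y∈) → there (proj₁ (∈-filter⁻ _ (ys⊆G₁ y∈))) })
      , List.tabulate (λ z∈ys → let (z∈G₀ , z≢σy) = ∈-filter⁻ _ (ys⊆G₁ z∈ys) in (λ z≡y → List.lookup y∉G₀ z∈G₀ (sym z≡y)) , z≢σy) ∷ pairs
    where
    G₁ = filter (λ z → ¬? (z ≟ σ y)) G₀
    room : 2 * k ≤ length G₁
    room = ≤-pred (≤-trans (≤-pred (subst (_≤ suc (length G₀)) (*-suc 2 k) le)) (length-filter-≢ (σ y) G₀ u))

-- Stars: four sets through a point

Spoke : List Point → Point → Point → Set
Spoke S x d = x ⊞ d ∈ S × x ⊞ negV d ∈ S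

Apart : Point → Point → Set
Apart u v = v ≢ u × v ≢ negV u

record Star (S : List Point) (x : Point) : Set where
  field
    d₁ d₂ d₃ d₄ : Point
    spoke₁ : Spoke S x d₁
    spoke₂ : Spoke S x d₂
    spoke₃ : Spoke S x d₃
    spoke₄ : Spoke S x d₄
    d₁≢0 : d₁ ≢ origin
    d₂≢0 : d₂ ≢ origin
    d₃≢0 : d₃ ≢ origin
    d₄≢0 : d₄ ≢ origin
    apart₁₂ : Apart d₁ d₂
    apart₁₃ : Apart d₁ d₃
    apart₂₃ : Apart d₂ d₃
    apart₁₄ : Apart d₁ d₄
    apart₂₄ : Apart d₂ d₄
    apart₃₄ : Apart d₃ d₄

translate-back : ∀ (x y : Point) → x ⊞ (y ⊞ negV x) ≡ y
translate-back x y = trans (sym (⊞-assoc x y (negV x))) (xyx⁻¹≈y x y)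

translate-third : ∀ (x y : Point) → x ⊞ negV (y ⊞ negV x) ≡ third x y
translate-third x y = begin
  x ⊞ negV (y ⊞ negV x)       ≡⟨ cong (x ⊞_) (sym (⁻¹-∙-comm y (negV x))) ⟩
  x ⊞ (negV y ⊞ negV (negV x)) ≡⟨ cong (λ z → x ⊞ (negV y ⊞ z)) (⁻¹-involutive x) ⟩
  x ⊞ (negV y ⊞ x)             ≡⟨ x∙yz≈y∙xz x (negV y) x ⟩
  negV y ⊞ (x ⊞ x)             ≡⟨ cong (negV y ⊞_) (⊞-double x) ⟩
  negV y ⊞ negV x              ≡⟨ ⁻¹-∙-comm y x ⟩
  negV (y ⊞ x)                 ≡⟨ cong negV (⊞-comm y x) ⟩
  third x y                    ∎
  where open ≡-Reasoning

module Directions (x : Point) where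

  δ : Point → Point
  δ y = y ⊞ negV x

  δ-injective : ∀ {a b} → δ a ≡ δ b → a ≡ b
  δ-injective {a} {b} e = trans (sym (translate-back x a)) (trans (cong (x ⊞_) e) (translate-back x b))

  δ-third : ∀ y → δ (third x y) ≡ negV (δ y)
  δ-third y = trans (cong δ (sym (translate-third x y))) (xyx⁻¹≈y x (negV (δ y)))

  δ-spoke : ∀ {S y} → y ∈ S → third x y ∈ S → Spoke S x (δ y)
  δ-spoke {S} {y} y∈ t∈ = subst (_∈ S) (sym (translate-back x y)) y∈ , subst (_∈ S) (sym (translate-third x y)) t∈

  δ-nonzero : ∀ {y} → y ≢ x → δ y ≢ origin
  δ-nonzero y≢x e = y≢x (δ-injective (trans e (sym (⊞-inverseʳ x))))

  δ-apart : ∀ {a b} → b ≢ a × b ≢ third x a → Apart (δ a) (δ b)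
  δ-apart (b≢a , b≢t) = (λ e → b≢a (δ-injective e)) , (λ e → b≢t (δ-injective (trans e (sym (δ-third _)))))

  δ-lines : LinePreserving δ
  δ-lines p q r sum≡0 = begin
    (δ p ⊞ δ q) ⊞ δ r                                   ≡⟨ cong (_⊞ δ r) (interchange p (negV x) q (negV x)) ⟩
    ((p ⊞ q) ⊞ (negV x ⊞ negV x)) ⊞ (r ⊞ negV x)        ≡⟨ interchange (p ⊞ q) (negV x ⊞ negV x) r (negV x) ⟩
    ((p ⊞ q) ⊞ r) ⊞ ((negV x ⊞ negV x) ⊞ negV x)        ≡⟨ cong₂ _⊞_ sum≡0 (cong (_⊞ negV x) (⊞-double (negV x))) ⟩
    origin ⊞ (negV (negV x) ⊞ negV x)                   ≡⟨ ⊞-identityˡ _ ⟩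
    negV (negV x) ⊞ negV x                              ≡⟨ ⊞-inverseˡ (negV x) ⟩
    origin                                              ∎
    where open ≡-Reasoning

remove : ∀ {x : Point} {xs} → x ∈ xs → ∃ λ ys → xs ↭ x ∷ ys
remove {x} x∈ with ys , zs , refl ← ∈-∃++ x∈ = ys ++ zs , shift x ys zs

module _ {S : List Point} {x : Point} where
  open Directions x

  private
    InLine : Point → Set
    InLine y = y ∈ S × third x y ∈ S × y ≢ x

    star-of-four : (ys : List Point) → length ys ≡ 4 → (∀ {y} → y ∈ ys → InLine y) →
      AllPairs (λ a b → b ≢ a × b ≢ third x a) ys → Star S x
    star-of-four (y₁ ∷ y₂ ∷ y₃ ∷ y₄ ∷ []) _ inLine ((a₁₂ ∷ a₁₃ ∷ a₁₄ ∷ []) ∷ (a₂₃ ∷ a₂₄ ∷ []) ∷ (a₃₄ ∷ []) ∷ [] ∷ []) =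
      record
        { d₁ = δ y₁ ; d₂ = δ y₂ ; d₃ = δ y₃ ; d₄ = δ y₄
        ; spoke₁ = spoke (here refl) ; spoke₂ = spoke (there (here refl))
        ; spoke₃ = spoke (there (there (here refl))) ; spoke₄ = spoke (there (there (there (here refl))))
        ; d₁≢0 = nonzero (here refl) ; d₂≢0 = nonzero (there (here refl))
        ; d₃≢0 = nonzero (there (there (here refl))) ; d₄≢0 = nonzero (there (there (there (here refl))))
        ; apart₁₂ = δ-apart a₁₂ ; apart₁₃ = δ-apart a₁₃ ; apart₂₃ = δ-apart a₂₃
        ; apart₁₄ = δ-apart a₁₄ ; apart₂₄ = δ-apart a₂₄ ; apart₃₄ = δ-apart a₃₄ }
      where
      spoke : ∀ {y} → y ∈ y₁ ∷ y₂ ∷ y₃ ∷ y₄ ∷ [] → Spoke S x (δ y)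
      spoke y∈ = let (y∈S , t∈S , _) = inLine y∈ in δ-spoke y∈S t∈S
      nonzero : ∀ {y} → y ∈ y₁ ∷ y₂ ∷ y₃ ∷ y₄ ∷ [] → δ y ≢ origin
      nonzero y∈ = δ-nonzero (proj₂ (proj₂ (inLine y∈)))
    star-of-four (_ ∷ _ ∷ _ ∷ _ ∷ _ ∷ _) () _ _

  star-at : Unique S → x ∈ S → 8 < linePairs x S → Star S x
  star-at uniq x∈S many with remove x∈S
  ... | S′ , π with Unique-resp-↭ (↭⇒↭ₛ π) uniq
  ...   | x∉S′ ∷ uniq′ with spread _≟ₚ_ (third x) 4 G (Unique.filter⁺ _ uniq′) eight≤G
    where
    g : Point → ℕ
    g y = countWith2 x y S
    G = filter (λ y → third x y ∈? S) S′
    eight≤G : 8 ≤ length G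
    eight≤G = ≤-trans
      (≤-pred (≤-trans many (≤-trans (≤-reflexive (∑-↭ g π)) (+-monoˡ-≤ (∑ g S′) (countWith2≤1 x x uniq)))))
      (∑-≤-filter _ g S′ (λ y → countWith2≤1 x y uniq) (λ y → countWith2-pos x y S))
  ...     | ys , len , ys⊆G , pairs = star-of-four ys len inLine pairs
    where
    inLine : ∀ {y} → y ∈ ys → InLine y
    inLine y∈ys = let (y∈S′ , t∈S) = ∈-filter⁻ _ (ys⊆G y∈ys) in
      ∈-resp-↭ (↭-sym π) (there y∈S′) , t∈S , λ y≡x → List.lookup x∉S′ y∈S′ (sym y≡x)

star : ∀ {S} → Unique S → length S ≡ 12 → 14 < numSets S → ∃ λ x → x ∈ S × Star S x
star {S} uniq len many with ∑-large (λ x → linePairs x S) 8 S eight<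
  where
  eight< : 8 * length S < ∑ (λ x → linePairs x S) S
  eight< = subst₂ _<_ (cong (8 *_) (sym len)) (sym (trans (∑linePairs S uniq) (cong (6 * numSets S +_) len)))
             (≤-trans (m≤m+n 97 5) (+-monoˡ-≤ 12 (*-monoʳ-≤ 6 many)))
... | x , x∈S , many-pairs = x , x∈S , star-at uniq x∈S many-pairs

-- Coordinates adapted to a star

infix 4 _±∈_
_±∈_ : Point → List Point → Set
v ±∈ T = v ∈ T × negV v ∈ T

record Frame (S : List Point) (x : Point) (us : Vec Point 4) : Set where
  field
    image    : List Point
    unique   : Unique image
    length≡  : length image ≡ length S
    origin∈  : origin ∈ image
    spoke    : ∀ cs → Spoke S x (lin cs us) → cs ±∈ image
    numSets≤ : numSets S ≤ numSets image

frame : ∀ {S x us} → Unique S → x ∈ S → Independent us → Frame S x us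
frame {S} {x} {us} uniq x∈S ind = record
  { image    = mapL H S
  ; unique   = Unique.map⁺ (λ e → δ-injective (coord-injective e)) uniq
  ; length≡  = length-map H S
  ; origin∈  = subst (_∈ mapL H S) (trans (cong coord (⊞-inverseʳ x)) coord-0) (∈-map⁺ H x∈S)
  ; spoke    = λ cs (p∈ , m∈) →
      subst (_∈ mapL H S) (trans (cong coord (xyx⁻¹≈y x (lin cs us))) (coord-lin cs)) (∈-map⁺ H p∈) ,
      subst (_∈ mapL H S) (trans (cong coord (trans (xyx⁻¹≈y x (negV (lin cs us))) (sym (lin-neg cs us)))) (coord-lin (negV cs))) (∈-map⁺ H m∈)
  ; numSets≤ = numSets-map-≤ H-lines S }
  where
  open Directions x
  open Coordinates (coordinates ind)
  H : Point → Point
  H z = coord (δ z)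
  coord-0 : coord origin ≡ origin
  coord-0 = trans (cong coord (sym (lin-0V us))) (coord-lin 0V)
  H-lines : LinePreserving H
  H-lines p q r sum≡0 = trans
    (sym (trans (coord-⊞ (δ p ⊞ δ q) (δ r)) (cong (_⊞ H r) (coord-⊞ (δ p) (δ q)))))
    (trans (cong coord (δ-lines p q r sum≡0)) coord-0)

-- Bounding the sets of a twelve-point set from a nine-point subset

record Extension (T B : List Point) : Set where
  field
    y₁ y₂ y₃ : Point
    perm     : T ↭ y₁ ∷ y₂ ∷ y₃ ∷ B

split-off : ∀ {T} B → Unique T → Unique B → List.All (_∈ T) B → ∃ λ R → T ↭ B ++ R
split-off {T} []      _  _            _           = T , ↭-refl
split-off {T} (b ∷ B) uT (b∉B ∷ uB) (b∈T ∷ B⊆T) with remove b∈T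
... | T₁ , π with Unique-resp-↭ (↭⇒↭ₛ π) uT
...   | _ ∷ uT₁ with split-off B uT₁ uB (List.tabulate λ z∈B → still-in (List.lookup B⊆T z∈B) (List.lookup b∉B z∈B))
  where
  still-in : ∀ {z} → z ∈ T → b ≢ z → z ∈ T₁
  still-in z∈T b≢z with ∈-resp-↭ π z∈T
  ... | here z≡b  = ⊥-elim (b≢z (sym z≡b))
  ... | there z∈ = z∈
...     | R , ρ = R , ↭-trans π (prep b ρ)

-- Abstract, so that type checking never unfolds the three new points.
abstract
  extension : ∀ {T B} → Unique T → length T ≡ 12 → Unique B → length B ≡ 9 → List.All (_∈ T) B → Extension T B
  extension {T} {B} uT lT uB lB B⊆T with split-off B uT uB B⊆T
  ... | R , π = three R (+-cancelˡ-≡ 9 (length R) 3 (begin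
      9 + length R          ≡⟨ cong (_+ length R) lB ⟨
      length B + length R   ≡⟨ length-++ B ⟨
      length (B ++ R)       ≡⟨ ↭-length π ⟨
      length T              ≡⟨ lT ⟩
      12                    ∎)) (↭-trans π (++-comm B R))
    where
    open ≡-Reasoning
    three : ∀ R → length R ≡ 3 → T ↭ R ++ B → Extension T B
    three (y₁ ∷ y₂ ∷ y₃ ∷ []) _ perm = record { y₁ = y₁ ; y₂ = y₂ ; y₃ = y₃ ; perm = perm }
    three (_ ∷ _ ∷ _ ∷ _ ∷ _) () _

newSets : Point → Point → Point → List Point → ℕ
newSets y₁ y₂ y₃ B = isSet y₁ y₂ y₃ + (countWith2 y₁ y₂ B + countWith2 y₁ y₃ B + countWith2 y₂ y₃ B)

numSets-split : ∀ y₁ y₂ y₃ B → numSets (y₁ ∷ y₂ ∷ y₃ ∷ B) ≡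
  newSets y₁ y₂ y₃ B + (countWith1 y₁ B + countWith1 y₂ B + countWith1 y₃ B) + numSets B
numSets-split y₁ y₂ y₃ B = arithmetic (isSet y₁ y₂ y₃) (countWith2 y₁ y₂ B) (countWith2 y₁ y₃ B) (countWith2 y₂ y₃ B)
  (countWith1 y₁ B) (countWith1 y₂ B) (countWith1 y₃ B) (numSets B)
  where
  arithmetic : ∀ l a b c p q r m → ((l + a) + (b + p)) + ((c + q) + (r + m)) ≡ (l + (a + b + c)) + (p + q + r) + m
  arithmetic = solve 8 (λ l a b c p q r m → ((l :+ a) :+ (b :+ p)) :+ ((c :+ q) :+ (r :+ m))
                                          := (l :+ (a :+ b :+ c)) :+ (p :+ q :+ r) :+ m) refl
    where open +-*-Solver

newSets-of-set : ∀ {y₁ y₂ y₃ B} → y₁ ∉ B → y₂ ∉ B → y₃ ∉ B → isSet y₁ y₂ y₃ ≡ 1 →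
  countWith2 y₁ y₂ B + countWith2 y₁ y₃ B + countWith2 y₂ y₃ B ≡ 0
newSets-of-set {y₁} {y₂} {y₃} {B} y₁∉ y₂∉ y₃∉ set = cong₂ _+_ (cong₂ _+_
  (countWith2-∉ y₁ y₂ B (λ t∈ → y₃∉ (subst (_∈ B) (sym (isSet≡1⇒third y₁ y₂ y₃ set)) t∈)))
  (countWith2-∉ y₁ y₃ B (λ t∈ → y₂∉ (subst (_∈ B) (sym (isSet≡1⇒third y₁ y₃ y₂ (trans (sym (isSet-swap₂₃ y₁ y₂ y₃)) set))) t∈))))
  (countWith2-∉ y₂ y₃ B (λ t∈ → y₁∉ (subst (_∈ B) (sym (isSet≡1⇒third y₂ y₃ y₁
    (trans (sym (trans (isSet-swap₁₂ y₁ y₂ y₃) (isSet-swap₂₃ y₂ y₁ y₃))) set))) t∈)))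

newSets≤3 : ∀ {y₁ y₂ y₃ B} → Unique B → y₁ ∉ B → y₂ ∉ B → y₃ ∉ B → newSets y₁ y₂ y₃ B ≤ 3
newSets≤3 {y₁} {y₂} {y₃} {B} uB y₁∉ y₂∉ y₃∉ with isSet-cases y₁ y₂ y₃
... | inj₁ none = subst (λ l → l + (countWith2 y₁ y₂ B + countWith2 y₁ y₃ B + countWith2 y₂ y₃ B) ≤ 3) (sym none)
  (+-mono-≤ (+-mono-≤ (countWith2≤1 y₁ y₂ uB) (countWith2≤1 y₁ y₃ uB)) (countWith2≤1 y₂ y₃ uB))
... | inj₂ set  = ≤-trans (≤-reflexive (cong₂ _+_ set (newSets-of-set y₁∉ y₂∉ y₃∉ set))) (s≤s z≤n)

Closed : List Point → Set
Closed B = ∀ {p q} → p ∈ B → q ∈ B → third p q ∈ B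

third-triangle : (a b c : Vec F3 n) → third (third b c) (third (third a b) (third a c)) ≡ a
third-triangle []      []      []      = refl
third-triangle (a ∷ u) (b ∷ v) (c ∷ w) = cong₂ _∷_ (scalar a b c) (third-triangle u v w)
  where
  scalar : ∀ a b c → neg₃ (neg₃ (b +₃ c) +₃ neg₃ (neg₃ (a +₃ b) +₃ neg₃ (a +₃ c))) ≡ a
  scalar = from-yes (Fin.all? λ a → Fin.all? λ b → Fin.all? λ c →
    neg₃ (neg₃ (b +₃ c) +₃ neg₃ (neg₃ (a +₃ b) +₃ neg₃ (a +₃ c))) Fin.≟ a)

countWith1-closed : ∀ {B y} → Closed B → y ∉ B → ∀ xs → (∀ {z} → z ∈ xs → z ∈ B) → countWith1 y xs ≡ 0
countWith1-closed         closed y∉ []       _    = refl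
countWith1-closed {B} {y} closed y∉ (b ∷ bs) bs⊆B = cong₂ _+_
  (trans (countWith2≡∑ y b bs) (∑-zero bs λ r r∈ → trans (isSet-swap₁₂ y b r) (trans (isSet-swap₂₃ b y r)
    (isSet-≢third b r y λ { refl → y∉ (closed (bs⊆B (here refl)) (bs⊆B (there r∈))) }))))
  (countWith1-closed closed y∉ bs (bs⊆B ∘ there))

at-most-two : ∀ a b c → a ≤ 1 → b ≤ 1 → c ≤ 1 → ¬ (1 ≤ a × 1 ≤ b × 1 ≤ c) → a + b + c ≤ 2
at-most-two 0             b             c _        b≤1      c≤1      _   = +-mono-≤ b≤1 c≤1
at-most-two 1             0             c _        _        c≤1      _   = s≤s c≤1
at-most-two 1             1             0 _        _        _        _   = ≤-refl
at-most-two 1             1             1 _        _        _        all = ⊥-elim (all (≤-refl , ≤-refl , ≤-refl))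
at-most-two 1             1             (suc (suc _)) _ _   (s≤s ()) _
at-most-two 1             (suc (suc _)) _ _        (s≤s ()) _        _
at-most-two (suc (suc _)) _             _ (s≤s ()) _        _        _

-- Over a closed base, the three sets joining pairs of new points cannot all exist.
newSets≤2 : ∀ {y₁ y₂ y₃ B} → Closed B → Unique B → y₁ ∉ B → y₂ ∉ B → y₃ ∉ B → newSets y₁ y₂ y₃ B ≤ 2
newSets≤2 {y₁} {y₂} {y₃} {B} closed uB y₁∉ y₂∉ y₃∉ with isSet-cases y₁ y₂ y₃
... | inj₂ set  = ≤-trans (≤-reflexive (cong₂ _+_ set (newSets-of-set y₁∉ y₂∉ y₃∉ set))) (s≤s z≤n)
... | inj₁ none = subst (λ l → l + (countWith2 y₁ y₂ B + countWith2 y₁ y₃ B + countWith2 y₂ y₃ B) ≤ 2) (sym none)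
  (at-most-two _ _ _ (countWith2≤1 y₁ y₂ uB) (countWith2≤1 y₁ y₃ uB) (countWith2≤1 y₂ y₃ uB) λ (p₁₂ , p₁₃ , p₂₃) →
    y₁∉ (subst (_∈ B) (third-triangle y₁ y₂ y₃)
      (closed (countWith2-pos y₂ y₃ B p₂₃) (closed (countWith2-pos y₁ y₂ B p₁₂) (countWith2-pos y₁ y₃ B p₁₃)))))

module _ {T B : List Point} (uT : Unique T) (E : Extension T B) where
  open Extension E

  private
    u : Unique (y₁ ∷ y₂ ∷ y₃ ∷ B)
    u = Unique-resp-↭ (↭⇒↭ₛ perm) uT
    uB : Unique B
    uB with _ ∷ _ ∷ _ ∷ uB ← u = uB
    ∉B : ∀ {y} → y ∈ y₁ ∷ y₂ ∷ y₃ ∷ [] → y ∉ B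
    ∉B y∈ y∈B with u
    ... | (_ ∷ _ ∷ y₁∉) ∷ (_ ∷ y₂∉) ∷ y₃∉ ∷ _ with y∈
    ...   | here refl                 = List.lookup y₁∉ y∈B refl
    ...   | there (here refl)         = List.lookup y₂∉ y∈B refl
    ...   | there (there (here refl)) = List.lookup y₃∉ y∈B refl

  new∈T : ∀ {y} → y ∈ y₁ ∷ y₂ ∷ y₃ ∷ [] → y ∈ T
  new∈T (here refl)                 = ∈-resp-↭ (↭-sym perm) (here refl)
  new∈T (there (here refl))         = ∈-resp-↭ (↭-sym perm) (there (here refl))
  new∈T (there (there (here refl))) = ∈-resp-↭ (↭-sym perm) (there (there (here refl)))

  new-distinct : y₁ ≢ y₂ × y₁ ≢ y₃ × y₂ ≢ y₃
  new-distinct with u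
  ... | (y₁≢y₂ ∷ y₁≢y₃ ∷ _) ∷ (y₂≢y₃ ∷ _) ∷ _ = y₁≢y₂ , y₁≢y₃ , y₂≢y₃

  extension-bound : numSets T ≤ 3 + (countWith1 y₁ B + countWith1 y₂ B + countWith1 y₃ B) + numSets B
  extension-bound = subst (_≤ _) (sym (trans (numSets-↭ perm) (numSets-split y₁ y₂ y₃ B)))
    (+-monoˡ-≤ (numSets B) (+-monoˡ-≤ _ (newSets≤3 uB (∉B (here refl)) (∉B (there (here refl))) (∉B (there (there (here refl)))))))

  closed-extension-bound : Closed B → numSets T ≤ 2 + numSets B
  closed-extension-bound closed = subst (_≤ 2 + numSets B) (sym (trans (numSets-↭ perm) (numSets-split y₁ y₂ y₃ B)))
    (+-monoˡ-≤ (numSets B) (+-mono-≤ (newSets≤2 closed uB (∉B (here refl)) (∉B (there (here refl))) (∉B (there (there (here refl)))))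
      (≤-reflexive (cong₂ _+_ (cong₂ _+_ (no-pairs (here refl)) (no-pairs (there (here refl)))) (no-pairs (there (there (here refl))))))))
    where
    no-pairs : ∀ {y} → y ∈ y₁ ∷ y₂ ∷ y₃ ∷ [] → countWith1 y B ≡ 0
    no-pairs y∈ = countWith1-closed closed (∉B y∈) B (λ z∈ → z∈)

  weighted-bound : (β : Point → ℕ) → (∀ y → y ∈ T → y ∉ B → countWith1 y B ≤ β y) →
    numSets T ≤ 3 + (β y₁ + β y₂ + β y₃) + numSets B
  weighted-bound β weights = ≤-trans extension-bound
    (+-monoˡ-≤ (numSets B) (+-monoʳ-≤ 3 (+-mono-≤ (+-mono-≤ (weight (here refl)) (weight (there (here refl))))
                                                  (weight (there (there (here refl)))))))
    where
    weight : ∀ {y} → y ∈ y₁ ∷ y₂ ∷ y₃ ∷ [] → countWith1 y B ≤ β y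
    weight y∈ = weights _ (new∈T y∈) (∉B y∈)

-- The four canonical configurations

±list : List Point → List Point
±list []       = []
±list (v ∷ vs) = v ∷ negV v ∷ ±list vs

starBase : List Point → List Point
starBase vs = origin ∷ ±list vs

starBase⊆ : ∀ {T vs} → origin ∈ T → List.All (_±∈ T) vs → List.All (_∈ T) (starBase vs)
starBase⊆ {T} o∈ spokes = o∈ ∷ pairs spokes
  where
  pairs : ∀ {vs} → List.All (_±∈ T) vs → List.All (_∈ T) (±list vs)
  pairs []                   = []
  pairs ((v∈ , -v∈) ∷ rest) = v∈ ∷ -v∈ ∷ pairs rest

e₀ e₁ e₂ e₃ : Point
e₀ = unitVec 0F
e₁ = unitVec 1F
e₂ = unitVec 2F
e₃ = unitVec 3F

planeBase : List Point
planeBase = starBase (e₂ ∷ e₃ ∷ (0F ∷ 0F ∷ 1F ∷ 1F ∷ []) ∷ (0F ∷ 0F ∷ 1F ∷ 2F ∷ []) ∷ [])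

planeBase-closed : Closed planeBase
planeBase-closed p∈ q∈ = List.lookup (List.lookup closure p∈) q∈
  where
  closure : List.All (λ p → List.All (λ q → third p q ∈ planeBase) planeBase) planeBase
  closure = from-yes (List.all? (λ p → List.all? (λ q → third p q ∈? planeBase) planeBase) planeBase)

plane-bound : ∀ {T} → Unique T → length T ≡ 12 → List.All (_∈ T) planeBase → numSets T ≤ 14
plane-bound uT lT plane⊆T =
  closed-extension-bound uT (extension uT lT (from-yes (unique? planeBase)) refl plane⊆T) planeBase-closed

rank4Base : List Point
rank4Base = starBase (e₀ ∷ e₁ ∷ e₂ ∷ e₃ ∷ [])

rank4-bound : ∀ {T} → Unique T → length T ≡ 12 → List.All (_∈ T) rank4Base → numSets T ≤ 14
rank4-bound uT lT base⊆T = ≤-trans (weighted-bound uT (extension uT lT (from-yes (unique? rank4Base)) refl base⊆T) (λ _ → 1) λ y _ → weights y)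
  (from-yes (3 + 3 + numSets rank4Base ≤? 14))
  where
  weights : ∀ y → y ∉ rank4Base → countWith1 y rank4Base ≤ 1
  weights = from-yes (every? 4 λ y → ¬? (y ∈? rank4Base) →-dec countWith1 y rank4Base ≤? 1)

fullBase : List Point
fullBase = starBase (e₁ ∷ e₂ ∷ e₃ ∷ (0F ∷ 1F ∷ 1F ∷ 1F ∷ []) ∷ [])

full-bound : ∀ {T} → Unique T → length T ≡ 12 → List.All (_∈ T) fullBase → numSets T ≤ 14
full-bound uT lT base⊆T = ≤-trans (weighted-bound uT (extension uT lT (from-yes (unique? fullBase)) refl base⊆T) (λ _ → 2) λ y _ → weights y)
  (from-yes (3 + 6 + numSets fullBase ≤? 14))
  where
  weights : ∀ y → y ∉ fullBase → countWith1 y fullBase ≤ 2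
  weights = from-yes (every? 4 λ y → ¬? (y ∈? fullBase) →-dec countWith1 y fullBase ≤? 2)

spike : Point → Point → ℕ
spike w y with y ≟ₚ w
... | yes _ = 3
... | no  _ = 1

spike-sum : ∀ w {y₁ y₂ y₃} → y₁ ≢ y₂ × y₁ ≢ y₃ × y₂ ≢ y₃ → spike w y₁ + spike w y₂ + spike w y₃ ≤ 5
spike-sum w {y₁} {y₂} {y₃} (y₁≢y₂ , y₁≢y₃ , y₂≢y₃) with y₁ ≟ₚ w | y₂ ≟ₚ w | y₃ ≟ₚ w
... | yes refl | yes refl | _        = ⊥-elim (y₁≢y₂ refl)
... | yes refl | _        | yes refl = ⊥-elim (y₁≢y₃ refl)
... | _        | yes refl | yes refl = ⊥-elim (y₂≢y₃ refl)
... | yes _    | no _     | no _     = ≤-refl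
... | no _     | yes _    | no _     = ≤-refl
... | no _     | no _     | yes _    = ≤-refl
... | no _     | no _     | no _     = s≤s (s≤s (s≤s z≤n))

triangleBase : List Point
triangleBase = starBase (e₁ ∷ e₂ ∷ e₃ ∷ (0F ∷ 0F ∷ 1F ∷ 1F ∷ []) ∷ [])

-- Together with ±e₂, ±e₃ and ±(e₂ + e₃), the points ±(e₂ - e₃) fill the plane spanned by e₂ and e₃.
e₂-e₃ : Point
e₂-e₃ = 0F ∷ 0F ∷ 1F ∷ 2F ∷ []

module _ {T : List Point} (uT : Unique T) (lT : length T ≡ 12) (o∈T : origin ∈ T) where

  private
    -- When -w ∉ T, at most one new point equals w, which lies on three sets through two base
    -- points; every other new point lies on at most one.
    spiked : ∀ w → w ∈ e₂-e₃ ∷ negV e₂-e₃ ∷ [] → negV w ∉ T → List.All (_∈ T) triangleBase → numSets T ≤ 14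
    spiked w w∈ -w∉T base⊆T =
      ≤-trans (weighted-bound uT E (spike w) (λ y y∈T y∉B → List.lookup weights w∈ y y∉B λ { refl → -w∉T y∈T }))
              (≤-trans (+-monoˡ-≤ (numSets triangleBase) (+-monoʳ-≤ 3 (spike-sum w (new-distinct uT E))))
                       (from-yes (3 + 5 + numSets triangleBase ≤? 14)))
      where
      E = extension uT lT (from-yes (unique? triangleBase)) refl base⊆T
      weights : List.All (λ w → ∀ y → y ∉ triangleBase → y ≢ negV w → countWith1 y triangleBase ≤ spike w y) (e₂-e₃ ∷ negV e₂-e₃ ∷ [])
      weights = from-yes (List.all? (λ w → every? 4 λ y →
        ¬? (y ∈? triangleBase) →-dec ¬? (y ≟ₚ negV w) →-dec countWith1 y triangleBase ≤? spike w y) (e₂-e₃ ∷ negV e₂-e₃ ∷ []))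

  triangle-bound : List.All (_±∈ T) (e₁ ∷ e₂ ∷ e₃ ∷ (0F ∷ 0F ∷ 1F ∷ 1F ∷ []) ∷ []) → numSets T ≤ 14
  triangle-bound spokes@(_ ∷ s₂ ∷ s₃ ∷ s₂₃ ∷ []) with e₂-e₃ ∈? T | negV e₂-e₃ ∈? T
  ... | yes v∈ | yes -v∈ = plane-bound uT lT (starBase⊆ o∈T (s₂ ∷ s₃ ∷ s₂₃ ∷ (v∈ , -v∈) ∷ []))
  ... | no  v∉ | _       = spiked (negV e₂-e₃) (there (here refl)) v∉ (starBase⊆ o∈T spokes)
  ... | yes _  | no -v∉  = spiked e₂-e₃ (here refl) -v∉ (starBase⊆ o∈T spokes)

-- Stars in canonical position

module _ {S : List Point} {x : Point} (uS : Unique S) (lS : length S ≡ 12) (x∈S : x ∈ S) where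

  private
    reframe : ∀ {us} → Independent us →
      (∀ {T} → Unique T → length T ≡ 12 → origin ∈ T →
        (∀ cs → Spoke S x (lin cs us) → cs ±∈ T) → (∀ i → Spoke S x (lookup us i) → unitVec i ±∈ T) → numSets T ≤ 14) →
      numSets S ≤ 14
    reframe {us} ind bound = ≤-trans numSets≤
      (bound unique (trans length≡ lS) origin∈ spoke (λ i → spoke (unitVec i) ∘ subst (Spoke S x) (sym (lin-unitVec i us))))
      where open Frame (frame uS x∈S ind)

  rank4-case : ∀ {s r q p} → Independent (s ∷ r ∷ q ∷ p ∷ []) →
    Spoke S x s → Spoke S x r → Spoke S x q → Spoke S x p → numSets S ≤ 14
  rank4-case ind ss sr sq sp = reframe ind λ uT lT o∈T spoke basis → rank4-bound uT lT (starBase⊆ o∈T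
    (basis 0F ss ∷ basis 1F sr ∷ basis 2F sq ∷ basis 3F sp ∷ []))

  full-case : ∀ {r q p} → Independent (r ∷ q ∷ p ∷ []) → Spoke S x r → Spoke S x q → Spoke S x p →
    Spoke S x (lin (1F ∷ 1F ∷ 1F ∷ []) (r ∷ q ∷ p ∷ [])) → numSets S ≤ 14
  full-case {r} {q} {p} ind sr sq sp sd with e , ind₄ ← extend (from-yes (3 ^ 3 <? 3 ^ 4)) ind =
    reframe ind₄ λ uT lT o∈T spoke basis → full-bound uT lT (starBase⊆ o∈T
      (basis 1F sr ∷ basis 2F sq ∷ basis 3F sp ∷
       spoke (0F ∷ 1F ∷ 1F ∷ 1F ∷ []) (subst (Spoke S x) (sym (lin-0∷ (1F ∷ 1F ∷ 1F ∷ []) e (r ∷ q ∷ p ∷ []))) sd) ∷ []))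

  triangle-case : ∀ {r q p} → Independent (r ∷ q ∷ p ∷ []) → Spoke S x r → Spoke S x q → Spoke S x p →
    Spoke S x (lin (0F ∷ 1F ∷ 1F ∷ []) (r ∷ q ∷ p ∷ [])) → numSets S ≤ 14
  triangle-case {r} {q} {p} ind sr sq sp sd with e , ind₄ ← extend (from-yes (3 ^ 3 <? 3 ^ 4)) ind =
    reframe ind₄ λ uT lT o∈T spoke basis → triangle-bound uT lT o∈T
      (basis 1F sr ∷ basis 2F sq ∷ basis 3F sp ∷
       spoke (0F ∷ 0F ∷ 1F ∷ 1F ∷ []) (subst (Spoke S x) (sym (lin-0∷ (0F ∷ 1F ∷ 1F ∷ []) e (r ∷ q ∷ p ∷ []))) sd) ∷ [])

  plane-case : ∀ {q p} → Independent (q ∷ p ∷ []) → Spoke S x q → Spoke S x p →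
    Spoke S x (lin (1F ∷ 1F ∷ []) (q ∷ p ∷ [])) → Spoke S x (lin (1F ∷ 2F ∷ []) (q ∷ p ∷ [])) → numSets S ≤ 14
  plane-case {q} {p} ind sq sp s₊ s₋
    with e , ind₃ ← extend (from-yes (3 ^ 2 <? 3 ^ 4)) ind
    with e′ , ind₄ ← extend (from-yes (3 ^ 3 <? 3 ^ 4)) ind₃ =
    reframe ind₄ λ uT lT o∈T spoke basis → plane-bound uT lT (starBase⊆ o∈T
      (basis 2F sq ∷ basis 3F sp ∷
       spoke (0F ∷ 0F ∷ 1F ∷ 1F ∷ []) (subst (Spoke S x) (sym (skip₂ (1F ∷ 1F ∷ []))) s₊) ∷
       spoke (0F ∷ 0F ∷ 1F ∷ 2F ∷ []) (subst (Spoke S x) (sym (skip₂ (1F ∷ 2F ∷ []))) s₋) ∷ []))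
    where
    skip₂ : ∀ cs → lin (0F ∷ 0F ∷ cs) (e′ ∷ e ∷ q ∷ p ∷ []) ≡ lin cs (q ∷ p ∷ [])
    skip₂ cs = trans (lin-0∷ (0F ∷ cs) e′ (e ∷ q ∷ p ∷ [])) (lin-0∷ cs e (q ∷ p ∷ []))

-- Every star lies in one of the canonical positions

multiple-not-apart : ∀ a (p : Point) {v} → a · p ≡ v → v ≢ origin → ¬ Apart p v
multiple-not-apart 0F p refl v≢0 _          = v≢0 refl
multiple-not-apart 1F p refl _   (v≢p , _)  = v≢p refl
multiple-not-apart 2F p refl _   (_ , v≢-p) = v≢-p refl

span₂-units : ∀ {a b} {q p v : Point} → lin (a ∷ b ∷ []) (q ∷ p ∷ []) ≡ v → v ≢ origin → Apart q v → Apart p v →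
  a ≢ 0F × b ≢ 0F
span₂-units {a} {b} {q} {p} e v≢0 q∦v p∦v =
  (λ { refl → multiple-not-apart b p (trans (sym (⊞-identityʳ (b · p))) (trans (sym (lin-0∷ (b ∷ []) q (p ∷ []))) e)) v≢0 p∦v }) ,
  (λ { refl → multiple-not-apart a q (trans (sym (⊞-identityʳ (a · q))) (trans (cong (a · q ⊞_) (sym (⊞-identityˡ 0V))) e)) v≢0 q∦v })

independent-pair : ∀ {q p : Point} → p ≢ origin → q ≢ origin → Apart p q → Independent (q ∷ p ∷ [])
independent-pair {q} {p} p≢0 q≢0 p∦q = independent-∷ (independent-∷ (λ { [] _ → refl }) λ { ([] , e) → p≢0 (sym e) })
  λ { (c ∷ [] , e) → multiple-not-apart c p (trans (sym (⊞-identityʳ (c · p))) e) q≢0 p∦q }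

module _ {S : List Point} {x : Point} where

  spoke-scale : ∀ {d} a → a ≢ 0F → Spoke S x d → Spoke S x (a · d)
  spoke-scale 0F a≢0 _          = ⊥-elim (a≢0 refl)
  spoke-scale 1F _   sd         = sd
  spoke-scale 2F _   (d∈ , -d∈) = -d∈ , subst (λ z → x ⊞ z ∈ S) (sym (⁻¹-involutive _)) d∈

  spoke-neg : ∀ {d} → Spoke S x (negV d) → Spoke S x d
  spoke-neg {d} (-d∈ , d∈) = subst (λ z → x ⊞ z ∈ S) (⁻¹-involutive d) d∈ , -d∈

apart-scale : ∀ {u v} a → a ≢ 0F → Apart u v → Apart (a · u) v
apart-scale 0F a≢0 _               = ⊥-elim (a≢0 refl)
apart-scale 1F _   u∦v             = u∦v
apart-scale {u} 2F _ (v≢u , v≢-u) = v≢-u , λ e → v≢u (trans e (⁻¹-involutive u))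

module _ {S : List Point} {x : Point} (uS : Unique S) (lS : length S ≡ 12) (x∈S : x ∈ S) (σ : Star S x) where
  open Star σ

  private
    spoke-at : ∀ {d c} → c ≡ d → Spoke S x d → Spoke S x c
    spoke-at refl sd = sd

    I₂₁ : Independent (d₂ ∷ d₁ ∷ [])
    I₂₁ = independent-pair d₁≢0 d₂≢0 apart₁₂

    coplanar : ∀ {q p} → Independent (q ∷ p ∷ []) → Spoke S x q → Spoke S x p → Apart q d₄ → Apart p d₄ →
      lin (1F ∷ 1F ∷ []) (q ∷ p ∷ []) ≡ d₃ → numSets S ≤ 14
    coplanar {q} {p} Iqp sq sp q∦d₄ p∦d₄ sum≡d₃ with inSpan? d₄ (q ∷ p ∷ [])
    ... | no  d₄∉                  = triangle-case uS lS x∈S (independent-∷ Iqp d₄∉) spoke₄ sq sp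
                                      (spoke-at (trans (lin-0∷ (1F ∷ 1F ∷ []) d₄ (q ∷ p ∷ [])) sum≡d₃) spoke₃)
    ... | yes (a ∷ b ∷ [] , d₄≡) = plane a b (span₂-units d₄≡ d₄≢0 q∦d₄ p∦d₄) d₄≡
      where
      qp = q ∷ p ∷ []
      plane : ∀ a b → a ≢ 0F × b ≢ 0F → lin (a ∷ b ∷ []) qp ≡ d₄ → numSets S ≤ 14
      plane 0F _  (a≢0 , _) _ = ⊥-elim (a≢0 refl)
      plane _  0F (_ , b≢0) _ = ⊥-elim (b≢0 refl)
      plane 1F 1F _ d₄≡ = ⊥-elim (proj₁ apart₃₄ (trans (sym d₄≡) sum≡d₃))
      plane 2F 2F _ d₄≡ = ⊥-elim (proj₂ apart₃₄ (trans (sym d₄≡) (trans (lin-neg (1F ∷ 1F ∷ []) qp) (cong negV sum≡d₃))))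
      plane 1F 2F _ d₄≡ = plane-case uS lS x∈S Iqp sq sp (spoke-at sum≡d₃ spoke₃) (spoke-at d₄≡ spoke₄)
      plane 2F 1F _ d₄≡ = plane-case uS lS x∈S Iqp sq sp (spoke-at sum≡d₃ spoke₃)
                            (spoke-neg (spoke-at (trans (sym (lin-neg (1F ∷ 2F ∷ []) qp)) d₄≡) spoke₄))

    coplanar₃ : ∀ a b → lin (a ∷ b ∷ []) (d₂ ∷ d₁ ∷ []) ≡ d₃ → numSets S ≤ 14
    coplanar₃ a b d₃≡ with a≢0 , b≢0 ← span₂-units d₃≡ d₃≢0 apart₂₃ apart₁₃ =
      coplanar (independent-scale (a ∷ b ∷ []) (a≢0 ∷ b≢0 ∷ []) I₂₁) (spoke-scale a a≢0 spoke₂) (spoke-scale b b≢0 spoke₁)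
        (apart-scale a a≢0 apart₂₄) (apart-scale b b≢0 apart₁₄) (trans (lin-scale (1F ∷ 1F ∷ []) (a ∷ b ∷ []) (d₂ ∷ d₁ ∷ [])) d₃≡)

    pair₄ : ∀ {r u v} c c′ → Independent (r ∷ u ∷ v ∷ []) → Spoke S x r → Spoke S x u → Spoke S x v →
      Apart u d₄ → Apart v d₄ → lin (c ∷ c′ ∷ []) (u ∷ v ∷ []) ≡ d₄ → numSets S ≤ 14
    pair₄ {r} {u} {v} c c′ I sr su sv u∦d₄ v∦d₄ d₄≡ with c≢0 , c′≢0 ← span₂-units d₄≡ d₄≢0 u∦d₄ v∦d₄ =
      triangle-case uS lS x∈S (independent-scale (1F ∷ c ∷ c′ ∷ []) ((λ ()) ∷ c≢0 ∷ c′≢0 ∷ []) I) sr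
        (spoke-scale c c≢0 su) (spoke-scale c′ c′≢0 sv)
        (spoke-at (trans (lin-scale (0F ∷ 1F ∷ 1F ∷ []) (1F ∷ c ∷ c′ ∷ []) (r ∷ u ∷ v ∷ [])) (trans (lin-0∷ (c ∷ c′ ∷ []) r (u ∷ v ∷ [])) d₄≡)) spoke₄)

    spanned₄ : Independent (d₃ ∷ d₂ ∷ d₁ ∷ []) → ∀ c₃ c₂ c₁ → lin (c₃ ∷ c₂ ∷ c₁ ∷ []) (d₃ ∷ d₂ ∷ d₁ ∷ []) ≡ d₄ →
      numSets S ≤ 14
    spanned₄ I₃ c₃ c₂ c₁ d₄≡ with c₃ Fin.≟ 0F | c₂ Fin.≟ 0F | c₁ Fin.≟ 0F
    ... | yes refl | _        | _        =
      pair₄ c₂ c₁ I₃ spoke₃ spoke₂ spoke₁ apart₂₄ apart₁₄ (trans (sym (lin-0∷ (c₂ ∷ c₁ ∷ []) d₃ (d₂ ∷ d₁ ∷ []))) d₄≡)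
    ... | no  _    | yes refl | _        =
      pair₄ c₃ c₁ (independent-swap I₃) spoke₂ spoke₃ spoke₁ apart₃₄ apart₁₄
        (trans (sym (lin-0∷ (c₃ ∷ c₁ ∷ []) d₂ (d₃ ∷ d₁ ∷ []))) (trans (lin-swap 0F c₃ (c₁ ∷ []) d₂ d₃ (d₁ ∷ [])) d₄≡))
    ... | no  _    | no  _    | yes refl =
      pair₄ c₃ c₂ (independent-swap (independent-swap₂ I₃)) spoke₁ spoke₃ spoke₂ apart₃₄ apart₂₄
        (trans (sym (lin-0∷ (c₃ ∷ c₂ ∷ []) d₁ (d₃ ∷ d₂ ∷ []))) (trans (lin-swap 0F c₃ (c₂ ∷ []) d₁ d₃ (d₂ ∷ [])) (trans (cong (c₃ · d₃ ⊞_) (lin-swap 0F c₂ [] d₁ d₂ [])) d₄≡)))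
    ... | no  c₃≢0 | no  c₂≢0 | no  c₁≢0 =
      full-case uS lS x∈S (independent-scale (c₃ ∷ c₂ ∷ c₁ ∷ []) (c₃≢0 ∷ c₂≢0 ∷ c₁≢0 ∷ []) I₃)
        (spoke-scale c₃ c₃≢0 spoke₃) (spoke-scale c₂ c₂≢0 spoke₂) (spoke-scale c₁ c₁≢0 spoke₁)
        (spoke-at (trans (lin-scale (1F ∷ 1F ∷ 1F ∷ []) (c₃ ∷ c₂ ∷ c₁ ∷ []) (d₃ ∷ d₂ ∷ d₁ ∷ [])) d₄≡) spoke₄)

  star-bound : numSets S ≤ 14
  star-bound with inSpan? d₃ (d₂ ∷ d₁ ∷ [])
  ... | yes (a ∷ b ∷ [] , d₃≡) = coplanar₃ a b d₃≡
  ... | no  d₃∉ with inSpan? d₄ (d₃ ∷ d₂ ∷ d₁ ∷ [])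
  ...   | no  d₄∉                        = rank4-case uS lS x∈S (independent-∷ (independent-∷ I₂₁ d₃∉) d₄∉) spoke₄ spoke₃ spoke₂ spoke₁
  ...   | yes (c₃ ∷ c₂ ∷ c₁ ∷ [] , d₄≡) = spanned₄ (independent-∷ I₂₁ d₃∉) c₃ c₂ c₁ d₄≡

upper-bound : (S : List Point) → Unique S → length S ≡ 12 → numSets S ≤ 14
upper-bound S uS lS with numSets S ≤? 14
... | yes ≤14 = ≤14
... | no  ≰14 with x , x∈S , σ ← star uS lS (≰⇒> ≰14) = star-bound uS lS x∈S σ

-- A plane (twelve sets) and three points on two further sets.
example : List Point
example = (0F ∷ 0F ∷ 0F ∷ 0F ∷ []) ∷ (1F ∷ 0F ∷ 0F ∷ 0F ∷ []) ∷ (2F ∷ 0F ∷ 0F ∷ 0F ∷ []) ∷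
          (0F ∷ 1F ∷ 0F ∷ 0F ∷ []) ∷ (1F ∷ 1F ∷ 0F ∷ 0F ∷ []) ∷ (2F ∷ 1F ∷ 0F ∷ 0F ∷ []) ∷
          (0F ∷ 2F ∷ 0F ∷ 0F ∷ []) ∷ (1F ∷ 2F ∷ 0F ∷ 0F ∷ []) ∷ (2F ∷ 2F ∷ 0F ∷ 0F ∷ []) ∷
          (0F ∷ 0F ∷ 1F ∷ 0F ∷ []) ∷ (0F ∷ 0F ∷ 2F ∷ 0F ∷ []) ∷ (0F ∷ 1F ∷ 2F ∷ 0F ∷ []) ∷ []

mainTheorem10 : ((S : List Point) → Unique S → length S ≡ 12 → numSets S ≤ 14)
    × ∃ (λ (S : List Point) → Unique S × length S ≡ 12 × numSets S ≡ 14)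
mainTheorem10 = upper-bound , example , from-yes (unique? example) , refl , refl
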